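{- Let $n\ge 2$ and let $t$ be a (non-plane) rooted binary tree with $n$ leaves. For an internal node $u$ of $t$ let $\lfloor t(u)\rfloor$ be the number of internal nodes in the subtree $t(u)$ of $t$ rooted at $u$, and let $s(t)$ be the number of symmetry nodes of $t$ (internal nodes whose two child subtrees are isomorphic as rooted trees). Then the number of ranked plane trees with $n$ leaves whose underlying tree (obtained by forgetting both the ranks and the left/right order) is $t$ equals \[ B(t)\,2^{\,n-1-s(t)},\qquad\text{where } B(t)=\frac{(n-1)!}{\prod_{u}\lfloor t(u)\rfloor}, \] the product running over all internal nodes $u$ of $t$.
   Context: All trees are finite rooted binary trees (every internal node has exactly two children; $n$ leaves means $n-1$ internal nodes), with unlabeled nodes, identified up to rooted-tree isomorphism. A plane tree is such a tree with the two children of each internal node ordered (left/right), identified up to order-preserving isomorphism. A ranked plane tree with $n$ leaves is a plane tree together with a bijection from its $n-1$ internal nodes to $\{1,\dots,n-1\}$ such that the root has rank $1$ and ranks strictly increase along every path from the root away from it; ranked plane trees are identified up to order- and rank-preserving isomorphism. -}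

module Defs where

open import Data.Nat using (ℕ; zero; suc; _+_; _*_; _<_)
open import Data.List using (List; []; _∷_; _++_)
open import Data.Product using (_×_; _,_)
open import Data.Sum using (_⊎_; inj₁; inj₂)
open import Data.Unit using (⊤)
open import Data.Bool using (if_then_else_)
open import Relation.Binary.PropositionalEquality using (_≡_)
open import Relation.Nullary using (Dec; yes; no)
open import Relation.Nullary.Decidable using (map′; _×-dec_; _⊎-dec_; ⌊_⌋)
open import Function.Bundles using (mk⇔)

-- Plane (full) binary trees. A non-plane rooted binary tree is an
-- isomorphism class of plane trees under _≅_ below.

data Tree : Set where
  leaf : Tree
  node : Tree → Tree → Tree

leaves : Tree → ℕ
leaves leaf = 1
leaves (node l r) = leaves l + leaves r

internal : Tree → ℕ
internal leaf = 0
internal (node l r) = suc (internal l + internal r)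

prodSub : Tree → ℕ
prodSub leaf = 1
prodSub (node l r) = internal (node l r) * (prodSub l * prodSub r)

infix 4 _≅_
data _≅_ : Tree → Tree → Set where
  leaf≅    : leaf ≅ leaf
  straight : ∀ {a b c d} → a ≅ c → b ≅ d → node a b ≅ node c d
  crossed  : ∀ {a b c d} → a ≅ d → b ≅ c → node a b ≅ node c d

_≅?_ : (s t : Tree) → Dec (s ≅ t)
leaf ≅? leaf = yes leaf≅
leaf ≅? node _ _ = no (λ ())
node _ _ ≅? leaf = no (λ ())
node a b ≅? node c d =
  map′ to from (((a ≅? c) ×-dec (b ≅? d)) ⊎-dec ((a ≅? d) ×-dec (b ≅? c)))
  where
  to : ((a ≅ c) × (b ≅ d)) ⊎ ((a ≅ d) × (b ≅ c)) → node a b ≅ node c d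
  to (inj₁ (p , q)) = straight p q
  to (inj₂ (p , q)) = crossed p q
  from : node a b ≅ node c d → ((a ≅ c) × (b ≅ d)) ⊎ ((a ≅ d) × (b ≅ c))
  from (straight p q) = inj₁ (p , q)
  from (crossed p q) = inj₂ (p , q)

symNodes : Tree → ℕ
symNodes leaf = 0
symNodes (node l r) = (if ⌊ l ≅? r ⌋ then 1 else 0) + (symNodes l + symNodes r)

-- Ranked plane trees, represented as plane trees whose internal nodes
-- carry their rank. Order- and rank-preserving isomorphism of ranked
-- plane trees is then exactly syntactic equality.

data RTree : Set where
  leaf : RTree
  node : ℕ → RTree → RTree → RTree

shape : RTree → Tree
shape leaf = leaf
shape (node _ l r) = node (shape l) (shape r)

ranks : RTree → List ℕ
ranks leaf = []
ranks (node k l r) = k ∷ (ranks l ++ ranks r)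

Above : ℕ → RTree → Set
Above k leaf = ⊤
Above k (node m l r) = (k < m) × (Above m l × Above m r)

RootRankOne : RTree → Set
RootRankOne leaf = ⊤
RootRankOne (node m _ _) = m ≡ 1

module Submission where

-- A ranked plane tree is a plane tree together with a ranking of its internal
-- nodes, so the ranked plane trees over t are enumerated in two independent
-- stages, each a duplicate-free list of the right length:
--
--  * planeForms t lists the plane trees isomorphic to t.  Every internal node
--    of t contributes a factor 2 (its two children may be swapped), except a
--    symmetry node, where the swap yields the same plane tree; hence there are
--    2 ^ (⌊t⌋ ∸ s(t)) of them.
--  * rankings p xs lists the rankings of a plane tree p by an increasing list
--    of labels xs.  The root takes the least label and the remaining labels
--    are shared out between the two subtrees by an interleaving; counting the
--    interleavings by a binomial coefficient gives the hook-length identity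
--      |rankings p xs| · ∏ᵤ ⌊p(u)⌋ = ⌊p⌋!.

open import Defs
open import Data.Empty using (⊥; ⊥-elim)
open import Data.List using (List; []; _∷_; [_]; _++_; length; map; upTo; concatMap; cartesianProductWith)
open import Data.List.Membership.Propositional using (_∈_; find; lose)
open import Data.List.Membership.Propositional.Properties
  using (∈-++⁺ˡ; ∈-++⁺ʳ; ∈-++⁻; ∈-map⁺; ∈-map⁻; ∈-∃++; ∈-concatMap⁺; ∈-concatMap⁻; ∈-cartesianProductWith⁺; ∈-cartesianProductWith⁻)
open import Data.List.Properties using (length-++; length-map; length-upTo)
open import Data.List.Relation.Binary.Permutation.Propositional using (_↭_; ↭-refl; ↭-sym; ↭-trans; ↭-prep)
open import Data.List.Relation.Binary.Permutation.Propositional.Properties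
  using (∈-resp-↭; ↭-empty-inv; ↭-length; drop-∷; shift; ++⁺; ++⁺ˡ; ++⁺ʳ)
open import Data.List.Relation.Binary.Subset.Propositional using (_⊆_)
open import Data.List.Relation.Ternary.Interleaving using ([])
open import Data.List.Relation.Ternary.Interleaving.Propositional using (Interleaving; consˡ; consʳ; toPermutation)
open import Data.List.Relation.Unary.All as All using (All; []; _∷_)
import Data.List.Relation.Unary.All.Properties as Allₚ
open import Data.List.Relation.Unary.AllPairs as AllPairs using (AllPairs; []; _∷_)
import Data.List.Relation.Unary.AllPairs.Properties as AllPairsₚ
open import Data.List.Relation.Unary.Any using (here; there)
open import Data.List.Relation.Unary.Unique.Propositional using (Unique)
import Data.List.Relation.Unary.Unique.Propositional.Properties as Unique
open import Data.Nat using (ℕ; zero; suc; _+_; _*_; _∸_; _^_; _≤_; _<_; _!; z≤n; s≤s)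
open import Data.Nat.Properties
  using (+-suc; +-comm; suc-injective; *-comm; *-assoc; *-distribʳ-+; *-cancelʳ-≡; *-commutativeSemigroup;
         ^-distribˡ-+-*; m^n≢0; m∸n+n≡m; +-mono-≤; ≤-trans; n≤1+n; <-trans; <-asym; <⇒≢)
open import Data.Nat.Tactic.RingSolver using (solve-∀)
open import Data.Product using (Σ; ∃; ∃₂; _×_; _,_; proj₁; proj₂; map₁; map₂)
open import Data.Sum using (inj₁; inj₂)
open import Data.Unit using (tt)
open import Function using (_∘_; id)
open import Function.Bundles using (_⇔_; mk⇔)
open import Relation.Nullary using (yes; no; ¬_)
open import Relation.Binary.PropositionalEquality using (_≡_; refl; sym; trans; cong; cong₂; subst; subst₂; module ≡-Reasoning)

open import Algebra.Properties.CommutativeSemigroup *-commutativeSemigroup using (x∙yz≈y∙xz; interchange)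
open ≡-Reasoning

module _ {A B : Set} (F : A → List B) where

  ∈-concatMap-intro : ∀ {xs x y} → x ∈ xs → y ∈ F x → y ∈ concatMap F xs
  ∈-concatMap-intro {y = y} x∈xs y∈Fx = ∈-concatMap⁺ F (lose {P = λ x → y ∈ F x} x∈xs y∈Fx)

  ∈-concatMap-elim : ∀ {xs y} → y ∈ concatMap F xs → ∃ λ x → x ∈ xs × y ∈ F x
  ∈-concatMap-elim {xs} y∈ = find (∈-concatMap⁻ F {xs} y∈)

  concatMap-unique : ∀ {xs} → Unique xs → (∀ {x} → x ∈ xs → Unique (F x)) →
    (∀ {x x′ y} → x ∈ xs → x′ ∈ xs → y ∈ F x → y ∈ F x′ → x ≡ x′) →
    Unique (concatMap F xs)
  concatMap-unique {[]} [] _ _ = []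
  concatMap-unique {x ∷ xs} (x∉xs ∷ xs!) F! fibre =
    Unique.++⁺ (F! (here refl)) (concatMap-unique xs! (F! ∘ there) (λ p q → fibre (there p) (there q))) disjoint
    where
    disjoint : ∀ {y} → ¬ (y ∈ F x × y ∈ concatMap F xs)
    disjoint (y∈Fx , y∈rest) with ∈-concatMap-elim y∈rest
    ... | x′ , x′∈xs , y∈Fx′ = All.lookup x∉xs x′∈xs (fibre (here refl) (there x′∈xs) y∈Fx y∈Fx′)

  length-concatMap : ∀ xs {c d} → (∀ {x} → x ∈ xs → length (F x) * c ≡ d) →
    length (concatMap F xs) * c ≡ length xs * d
  length-concatMap [] _ = refl
  length-concatMap (x ∷ xs) {c} {d} each = begin
    length (F x ++ concatMap F xs) * c             ≡⟨ cong (_* c) (length-++ (F x)) ⟩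
    (length (F x) + length (concatMap F xs)) * c    ≡⟨ *-distribʳ-+ c (length (F x)) _ ⟩
    length (F x) * c + length (concatMap F xs) * c  ≡⟨ cong₂ _+_ (each (here refl)) (length-concatMap xs (each ∘ there)) ⟩
    d + length xs * d                               ∎

length-cartesianProductWith : ∀ {A B C : Set} (f : A → B → C) xs ys →
  length (cartesianProductWith f xs ys) ≡ length xs * length ys
length-cartesianProductWith f [] ys = refl
length-cartesianProductWith f (x ∷ xs) ys = begin
  length (map (f x) ys ++ cartesianProductWith f xs ys)            ≡⟨ length-++ (map (f x) ys) ⟩
  length (map (f x) ys) + length (cartesianProductWith f xs ys)     ≡⟨ cong₂ _+_ (length-map (f x) ys) (length-cartesianProductWith f xs ys) ⟩
  length ys + length xs * length ys                                 ∎

module _ {A : Set} where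

  interleaving-⊆ˡ : ∀ {l r ys : List A} → Interleaving l r ys → l ⊆ ys
  interleaving-⊆ˡ I z∈l = ∈-resp-↭ (↭-sym (toPermutation I)) (∈-++⁺ˡ z∈l)

  interleaving-⊆ʳ : ∀ {l r ys : List A} → Interleaving l r ys → r ⊆ ys
  interleaving-⊆ʳ {l} I z∈r = ∈-resp-↭ (↭-sym (toPermutation I)) (∈-++⁺ʳ l z∈r)

  interleaving-AllPairs : ∀ {R : A → A → Set} {l r ys} → Interleaving l r ys →
    AllPairs R ys → AllPairs R l × AllPairs R r
  interleaving-AllPairs [] [] = [] , []
  interleaving-AllPairs (consˡ I) (y~ys ∷ ys~) =
    let (l~ , r~) = interleaving-AllPairs I ys~ in Allₚ.anti-mono (interleaving-⊆ˡ I) y~ys ∷ l~ , r~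
  interleaving-AllPairs (consʳ I) (y~ys ∷ ys~) =
    let (l~ , r~) = interleaving-AllPairs I ys~ in l~ , Allₚ.anti-mono (interleaving-⊆ʳ I) y~ys ∷ r~

  interleaving-disjoint : ∀ {l r ys : List A} → Unique ys → Interleaving l r ys →
    ∀ {z} → z ∈ l → z ∈ r → ⊥
  interleaving-disjoint (y∉ys ∷ _) (consˡ I) (here refl) y∈r = All.lookup y∉ys (interleaving-⊆ʳ I y∈r) refl
  interleaving-disjoint (_ ∷ ys!) (consˡ I) (there z∈l) z∈r = interleaving-disjoint ys! I z∈l z∈r
  interleaving-disjoint (y∉ys ∷ _) (consʳ I) y∈l (here refl) = All.lookup y∉ys (interleaving-⊆ˡ I y∈l) refl
  interleaving-disjoint (_ ∷ ys!) (consʳ I) z∈l (there z∈r) = interleaving-disjoint ys! I z∈l z∈r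

  interleaving-determined : ∀ {l r l′ r′ ys : List A} → Unique ys →
    Interleaving l r ys → Interleaving l′ r′ ys → l ↭ l′ → (l , r) ≡ (l′ , r′)
  interleaving-determined [] [] [] _ = refl
  interleaving-determined (_ ∷ ys!) (consˡ I) (consˡ I′) l↭l′
    with interleaving-determined ys! I I′ (drop-∷ l↭l′)
  ... | refl = refl
  interleaving-determined (_ ∷ ys!) (consʳ I) (consʳ I′) l↭l′
    with interleaving-determined ys! I I′ l↭l′
  ... | refl = refl
  interleaving-determined (y∉ys ∷ _) (consˡ I) (consʳ I′) l↭l′ =
    ⊥-elim (All.lookup y∉ys (interleaving-⊆ˡ I′ (∈-resp-↭ l↭l′ (here refl))) refl)
  interleaving-determined (y∉ys ∷ _) (consʳ I) (consˡ I′) l↭l′ =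
    ⊥-elim (All.lookup y∉ys (interleaving-⊆ˡ I (∈-resp-↭ (↭-sym l↭l′) (here refl))) refl)

  ∈⇒↭∷ : ∀ {y : A} {xs} → y ∈ xs → ∃ λ xs′ → xs ↭ y ∷ xs′
  ∈⇒↭∷ {y} y∈xs with ∈-∃++ y∈xs
  ... | xs₁ , xs₂ , refl = xs₁ ++ xs₂ , shift y xs₁ xs₂

  -- Every decomposition of ys up to permutation is realised by an
  -- interleaving of ys: the head y of ys lies in as or in bs; moving it to
  -- the front there, the rest is an interleaving of the tail by induction.
  interleaving-of-↭ : ∀ (ys : List A) {as bs} → as ++ bs ↭ ys →
    ∃₂ λ l r → Interleaving l r ys × as ↭ l × bs ↭ r
  interleaving-of-↭ [] {[]} {[]} _ = [] , [] , [] , ↭-refl , ↭-refl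
  interleaving-of-↭ [] {[]} {_ ∷ _} ρ with () ← ↭-empty-inv ρ
  interleaving-of-↭ [] {_ ∷ _} ρ with () ← ↭-empty-inv ρ
  interleaving-of-↭ (y ∷ ys) {as} {bs} ρ with ∈-++⁻ as (∈-resp-↭ (↭-sym ρ) (here refl))
  ... | inj₁ y∈as =
    let (as′ , as↭) = ∈⇒↭∷ y∈as
        (l , r , I , as′↭l , bs↭r) = interleaving-of-↭ ys (drop-∷ (↭-trans (↭-sym (++⁺ʳ bs as↭)) ρ))
    in y ∷ l , r , consˡ I , ↭-trans as↭ (↭-prep y as′↭l) , bs↭r
  ... | inj₂ y∈bs =
    let (bs′ , bs↭) = ∈⇒↭∷ y∈bs
        (l , r , I , as↭l , bs′↭r) = interleaving-of-↭ ys (drop-∷ (↭-trans (↭-sym (↭-trans (++⁺ˡ as bs↭) (shift y as bs′))) ρ))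
    in l , y ∷ r , consʳ I , as↭l , ↭-trans bs↭ (↭-prep y bs′↭r)

  -- splits ys a b lists the pairs (l , r) with l of length a and r of length b
  -- into which ys is interleaved; splitsˡ/splitsʳ send the head of ys to the
  -- left/right part.
  splits : List A → ℕ → ℕ → List (List A × List A)
  splitsˡ splitsʳ : A → List A → ℕ → ℕ → List (List A × List A)
  splits [] zero zero = [ [] , [] ]
  splits [] zero (suc _) = []
  splits [] (suc _) _ = []
  splits (y ∷ ys) a b = splitsˡ y ys a b ++ splitsʳ y ys a b
  splitsˡ y ys zero b = []
  splitsˡ y ys (suc a) b = map (map₁ (y ∷_)) (splits ys a b)
  splitsʳ y ys a zero = []
  splitsʳ y ys a (suc b) = map (map₂ (y ∷_)) (splits ys a b)

  ∈-splits⁻ : ∀ ys a b {l r} → (l , r) ∈ splits ys a b →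
    Interleaving l r ys × length l ≡ a × length r ≡ b
  ∈-splitsˡ⁻ : ∀ y ys a b {l r} → (l , r) ∈ splitsˡ y ys a b →
    Interleaving l r (y ∷ ys) × length l ≡ a × length r ≡ b
  ∈-splitsʳ⁻ : ∀ y ys a b {l r} → (l , r) ∈ splitsʳ y ys a b →
    Interleaving l r (y ∷ ys) × length l ≡ a × length r ≡ b
  ∈-splits⁻ [] zero zero (here refl) = [] , refl , refl
  ∈-splits⁻ (y ∷ ys) a b lr∈ with ∈-++⁻ (splitsˡ y ys a b) lr∈
  ... | inj₁ lr∈ˡ = ∈-splitsˡ⁻ y ys a b lr∈ˡ
  ... | inj₂ lr∈ʳ = ∈-splitsʳ⁻ y ys a b lr∈ʳ
  ∈-splitsˡ⁻ y ys (suc a) b lr∈ with ∈-map⁻ (map₁ (y ∷_)) lr∈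
  ... | (l , r) , lr∈′ , refl =
    let (I , |l| , |r|) = ∈-splits⁻ ys a b lr∈′ in consˡ I , cong suc |l| , |r|
  ∈-splitsʳ⁻ y ys a (suc b) lr∈ with ∈-map⁻ (map₂ (y ∷_)) lr∈
  ... | (l , r) , lr∈′ , refl =
    let (I , |l| , |r|) = ∈-splits⁻ ys a b lr∈′ in consʳ I , |l| , cong suc |r|

  ∈-splits⁺ : ∀ {l r ys} → Interleaving l r ys → (l , r) ∈ splits ys (length l) (length r)
  ∈-splits⁺ [] = here refl
  ∈-splits⁺ (consˡ I) = ∈-++⁺ˡ (∈-map⁺ (map₁ (_ ∷_)) (∈-splits⁺ I))
  ∈-splits⁺ {l} {_ ∷ r} {y ∷ ys} (consʳ I) =
    ∈-++⁺ʳ (splitsˡ y ys (length l) (suc (length r))) (∈-map⁺ (map₂ (y ∷_)) (∈-splits⁺ I))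

  splits-unique : ∀ ys a b → Unique ys → Unique (splits ys a b)
  splits-unique [] zero zero _ = [] ∷ []
  splits-unique [] zero (suc _) _ = []
  splits-unique [] (suc _) _ _ = []
  splits-unique (y ∷ ys) a b y∷ys!@(_ ∷ ys!) = Unique.++⁺ (splitsˡ-unique a) (splitsʳ-unique b) disjoint
    where
    splitsˡ-unique : ∀ a → Unique (splitsˡ y ys a b)
    splitsˡ-unique zero = []
    splitsˡ-unique (suc a) = Unique.map⁺ (λ { {_ , _} {_ , _} refl → refl }) (splits-unique ys a b ys!)
    splitsʳ-unique : ∀ b → Unique (splitsʳ y ys a b)
    splitsʳ-unique zero = []
    splitsʳ-unique (suc b) = Unique.map⁺ (λ { {_ , _} {_ , _} refl → refl }) (splits-unique ys a b ys!)
    y-leftˡ : ∀ a {s} → s ∈ splitsˡ y ys a b → y ∈ proj₁ s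
    y-leftˡ (suc a) s∈ with ∈-map⁻ (map₁ (y ∷_)) s∈
    ... | _ , _ , refl = here refl
    y-rightʳ : ∀ b {s} → s ∈ splitsʳ y ys a b → y ∈ proj₂ s
    y-rightʳ (suc b) s∈ with ∈-map⁻ (map₂ (y ∷_)) s∈
    ... | _ , _ , refl = here refl
    disjoint : ∀ {s} → ¬ (s ∈ splitsˡ y ys a b × s ∈ splitsʳ y ys a b)
    disjoint {l , r} (s∈ˡ , s∈ʳ) =
      interleaving-disjoint y∷ys! (proj₁ (∈-splitsˡ⁻ y ys a b s∈ˡ)) (y-leftˡ a s∈ˡ) (y-rightʳ b s∈ʳ)

  splits-count : ∀ ys a b → length ys ≡ a + b → length (splits ys a b) * (a ! * b !) ≡ (a + b) !
  splits-count [] zero zero _ = refl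
  splits-count (y ∷ ys) a b |ys| = begin
    length (splitsˡ y ys a b ++ splitsʳ y ys a b) * (a ! * b !)
      ≡⟨ cong (_* (a ! * b !)) (length-++ (splitsˡ y ys a b)) ⟩
    (length (splitsˡ y ys a b) + length (splitsʳ y ys a b)) * (a ! * b !)
      ≡⟨ *-distribʳ-+ (a ! * b !) (length (splitsˡ y ys a b)) _ ⟩
    length (splitsˡ y ys a b) * (a ! * b !) + length (splitsʳ y ys a b) * (a ! * b !)
      ≡⟨ cong₂ _+_ (leftCount a |ys|) (rightCount b |ys|) ⟩
    a * length ys ! + b * length ys !  ≡⟨ *-distribʳ-+ (length ys !) a b ⟨
    (a + b) * length ys !              ≡⟨ cong (_* length ys !) |ys| ⟨
    suc (length ys) !                  ≡⟨ cong _! |ys| ⟩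
    (a + b) !                          ∎
    where
    -- the splits sending y left (right) are the splits of ys with one fewer
    -- element on the left (right)
    leftCount : ∀ a → suc (length ys) ≡ a + b → length (splitsˡ y ys a b) * (a ! * b !) ≡ a * length ys !
    leftCount zero _ = refl
    leftCount (suc a) |ys| = begin
      length (map (map₁ (y ∷_)) (splits ys a b)) * ((suc a * a !) * b !)
        ≡⟨ cong₂ _*_ (length-map (map₁ (y ∷_)) (splits ys a b)) (*-assoc (suc a) (a !) (b !)) ⟩
      length (splits ys a b) * (suc a * (a ! * b !))  ≡⟨ x∙yz≈y∙xz (length (splits ys a b)) (suc a) _ ⟩
      suc a * (length (splits ys a b) * (a ! * b !))  ≡⟨ cong (suc a *_) (splits-count ys a b (suc-injective |ys|)) ⟩
      suc a * (a + b) !                               ≡⟨ cong (λ m → suc a * m !) (suc-injective |ys|) ⟨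
      suc a * length ys !                             ∎
    rightCount : ∀ b → suc (length ys) ≡ a + b → length (splitsʳ y ys a b) * (a ! * b !) ≡ b * length ys !
    rightCount zero _ = refl
    rightCount (suc b) |ys| = begin
      length (map (map₂ (y ∷_)) (splits ys a b)) * (a ! * (suc b * b !))
        ≡⟨ cong₂ _*_ (length-map (map₂ (y ∷_)) (splits ys a b)) (x∙yz≈y∙xz (a !) (suc b) (b !)) ⟩
      length (splits ys a b) * (suc b * (a ! * b !))  ≡⟨ x∙yz≈y∙xz (length (splits ys a b)) (suc b) _ ⟩
      suc b * (length (splits ys a b) * (a ! * b !))  ≡⟨ cong (suc b *_) (splits-count ys a b |ys|′) ⟩
      suc b * (a + b) !                               ≡⟨ cong (λ m → suc b * m !) |ys|′ ⟨
      suc b * length ys !                             ∎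
      where
      |ys|′ : length ys ≡ a + b
      |ys|′ = suc-injective (trans |ys| (+-suc a b))

≅-sym : ∀ {s t} → s ≅ t → t ≅ s
≅-sym leaf≅ = leaf≅
≅-sym (straight p q) = straight (≅-sym p) (≅-sym q)
≅-sym (crossed p q) = crossed (≅-sym q) (≅-sym p)

≅-trans : ∀ {s t u} → s ≅ t → t ≅ u → s ≅ u
≅-trans leaf≅ q = q
≅-trans (straight p q) (straight p′ q′) = straight (≅-trans p p′) (≅-trans q q′)
≅-trans (straight p q) (crossed p′ q′) = crossed (≅-trans p p′) (≅-trans q q′)
≅-trans (crossed p q) (straight p′ q′) = crossed (≅-trans p q′) (≅-trans q p′)
≅-trans (crossed p q) (crossed p′ q′) = straight (≅-trans p q′) (≅-trans q p′)

≅-leaves : ∀ {s t} → s ≅ t → leaves s ≡ leaves t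
≅-leaves leaf≅ = refl
≅-leaves (straight p q) = cong₂ _+_ (≅-leaves p) (≅-leaves q)
≅-leaves (crossed {c = c} {d} p q) = trans (cong₂ _+_ (≅-leaves p) (≅-leaves q)) (+-comm (leaves d) (leaves c))

≅-internal : ∀ {s t} → s ≅ t → internal s ≡ internal t
≅-internal leaf≅ = refl
≅-internal (straight p q) = cong suc (cong₂ _+_ (≅-internal p) (≅-internal q))
≅-internal (crossed {c = c} {d} p q) = cong suc (trans (cong₂ _+_ (≅-internal p) (≅-internal q)) (+-comm (internal d) (internal c)))

≅-prodSub : ∀ {s t} → s ≅ t → prodSub s ≡ prodSub t
≅-prodSub leaf≅ = refl
≅-prodSub iso@(straight p q) = cong₂ _*_ (≅-internal iso) (cong₂ _*_ (≅-prodSub p) (≅-prodSub q))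
≅-prodSub iso@(crossed {c = c} {d} p q) =
  cong₂ _*_ (≅-internal iso) (trans (cong₂ _*_ (≅-prodSub p) (≅-prodSub q)) (*-comm (prodSub d) (prodSub c)))

leaves≡suc-internal : ∀ t → leaves t ≡ suc (internal t)
leaves≡suc-internal leaf = refl
leaves≡suc-internal (node l r) =
  trans (cong₂ _+_ (leaves≡suc-internal l) (leaves≡suc-internal r)) (cong suc (+-suc (internal l) (internal r)))

symNodes≤internal : ∀ t → symNodes t ≤ internal t
symNodes≤internal leaf = z≤n
symNodes≤internal (node l r) with l ≅? r
... | yes _ = s≤s (+-mono-≤ (symNodes≤internal l) (symNodes≤internal r))
... | no _ = ≤-trans (+-mono-≤ (symNodes≤internal l) (symNodes≤internal r)) (n≤1+n _)

-- Plane forms of a rooted tree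

joins : List Tree → List Tree → List Tree
joins = cartesianProductWith node

-- The plane trees isomorphic to t: at a symmetry node only one order of the
-- children is taken, since the other one gives the same plane trees.
planeForms : Tree → List Tree
planeForms leaf = [ leaf ]
planeForms (node l r) with l ≅? r
... | yes _ = joins (planeForms l) (planeForms r)
... | no _ = joins (planeForms l) (planeForms r) ++ joins (planeForms r) (planeForms l)

joins-straight : ∀ {l r as bs p} → (∀ {a} → a ∈ as → a ≅ l) → (∀ {b} → b ∈ bs → b ≅ r) →
  p ∈ joins as bs → p ≅ node l r
joins-straight {as = as} {bs} as≅l bs≅r p∈ with ∈-cartesianProductWith⁻ node as bs p∈
... | a , b , a∈ , b∈ , refl = straight (as≅l a∈) (bs≅r b∈)

joins-crossed : ∀ {l r as bs p} → (∀ {a} → a ∈ as → a ≅ r) → (∀ {b} → b ∈ bs → b ≅ l) →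
  p ∈ joins as bs → p ≅ node l r
joins-crossed {as = as} {bs} as≅r bs≅l p∈ with ∈-cartesianProductWith⁻ node as bs p∈
... | a , b , a∈ , b∈ , refl = crossed (as≅r a∈) (bs≅l b∈)

planeForms-sound : ∀ t {p} → p ∈ planeForms t → p ≅ t
planeForms-sound leaf (here refl) = leaf≅
planeForms-sound (node l r) p∈ with l ≅? r
... | yes _ = joins-straight (planeForms-sound l) (planeForms-sound r) p∈
... | no _ with ∈-++⁻ (joins (planeForms l) (planeForms r)) p∈
...   | inj₁ p∈ˡ = joins-straight (planeForms-sound l) (planeForms-sound r) p∈ˡ
...   | inj₂ p∈ʳ = joins-crossed (planeForms-sound r) (planeForms-sound l) p∈ʳ

planeForms-complete : ∀ t {p} → p ≅ t → p ∈ planeForms t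
planeForms-complete leaf leaf≅ = here refl
planeForms-complete (node l r) (straight a≅l b≅r) with l ≅? r
... | yes _ = ∈-cartesianProductWith⁺ node (planeForms-complete l a≅l) (planeForms-complete r b≅r)
... | no _ = ∈-++⁺ˡ (∈-cartesianProductWith⁺ node (planeForms-complete l a≅l) (planeForms-complete r b≅r))
planeForms-complete (node l r) (crossed a≅r b≅l) with l ≅? r
... | yes l≅r = ∈-cartesianProductWith⁺ node (planeForms-complete l (≅-trans a≅r (≅-sym l≅r)))
                                             (planeForms-complete r (≅-trans b≅l l≅r))
... | no _ = ∈-++⁺ʳ (joins (planeForms l) (planeForms r))
               (∈-cartesianProductWith⁺ node (planeForms-complete r a≅r) (planeForms-complete l b≅l))

node-injective : ∀ {a b c d} → Tree.node a b ≡ node c d → a ≡ c × b ≡ d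
node-injective refl = refl , refl

joins-unique : ∀ {as bs} → Unique as → Unique bs → Unique (joins as bs)
joins-unique = Unique.cartesianProductWith⁺ node node-injective

planeForms-unique : ∀ t → Unique (planeForms t)
planeForms-unique leaf = [] ∷ []
planeForms-unique (node l r) with l ≅? r
... | yes _ = joins-unique (planeForms-unique l) (planeForms-unique r)
... | no l≇r = Unique.++⁺ (joins-unique (planeForms-unique l) (planeForms-unique r))
                          (joins-unique (planeForms-unique r) (planeForms-unique l)) disjoint
  where
  -- the left child of a tree in the first list is isomorphic to l, in the
  -- second one to r
  disjoint : ∀ {p} → ¬ (p ∈ joins (planeForms l) (planeForms r) × p ∈ joins (planeForms r) (planeForms l))
  disjoint (p∈ˡ , p∈ʳ)
    with ∈-cartesianProductWith⁻ node (planeForms l) (planeForms r) p∈ˡ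
       | ∈-cartesianProductWith⁻ node (planeForms r) (planeForms l) p∈ʳ
  ... | a , _ , a∈ , _ , refl | _ , _ , a∈′ , _ , refl =
    l≇r (≅-trans (≅-sym (planeForms-sound l a∈)) (planeForms-sound r a∈′))

-- Joining plane forms of the children: at a symmetry node one order is used
-- and the exponent of 2 grows by one, otherwise both orders are used.
planeForms-node-count : ∀ l r →
  length (planeForms (node l r)) * 2 ^ symNodes (node l r) ≡
  2 * ((length (planeForms l) * 2 ^ symNodes l) * (length (planeForms r) * 2 ^ symNodes r))
planeForms-node-count l r with l ≅? r
... | yes _ = begin
  length (joins (planeForms l) (planeForms r)) * 2 ^ suc (symNodes l + symNodes r)
    ≡⟨ cong₂ _*_ (length-cartesianProductWith node (planeForms l) (planeForms r))
                 (cong (2 *_) (^-distribˡ-+-* 2 (symNodes l) (symNodes r))) ⟩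
  (length (planeForms l) * length (planeForms r)) * (2 * (2 ^ symNodes l * 2 ^ symNodes r))
    ≡⟨ regroup (length (planeForms l)) (length (planeForms r)) (2 ^ symNodes l) (2 ^ symNodes r) ⟩
  2 * ((length (planeForms l) * 2 ^ symNodes l) * (length (planeForms r) * 2 ^ symNodes r)) ∎
  where
  regroup : ∀ a b c d → (a * b) * (2 * (c * d)) ≡ 2 * ((a * c) * (b * d))
  regroup = solve-∀
... | no _ = begin
  length (joins (planeForms l) (planeForms r) ++ joins (planeForms r) (planeForms l)) * 2 ^ (symNodes l + symNodes r)
    ≡⟨ cong₂ _*_ (trans (length-++ (joins (planeForms l) (planeForms r)))
                        (cong₂ _+_ (length-cartesianProductWith node (planeForms l) (planeForms r))
                                   (length-cartesianProductWith node (planeForms r) (planeForms l))))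
                 (^-distribˡ-+-* 2 (symNodes l) (symNodes r)) ⟩
  (length (planeForms l) * length (planeForms r) + length (planeForms r) * length (planeForms l))
    * (2 ^ symNodes l * 2 ^ symNodes r)
    ≡⟨ regroup (length (planeForms l)) (length (planeForms r)) (2 ^ symNodes l) (2 ^ symNodes r) ⟩
  2 * ((length (planeForms l) * 2 ^ symNodes l) * (length (planeForms r) * 2 ^ symNodes r)) ∎
  where
  regroup : ∀ a b c d → (a * b + b * a) * (c * d) ≡ 2 * ((a * c) * (b * d))
  regroup = solve-∀

planeForms-count : ∀ t → length (planeForms t) * 2 ^ symNodes t ≡ 2 ^ internal t
planeForms-count leaf = refl
planeForms-count (node l r) = begin
  length (planeForms (node l r)) * 2 ^ symNodes (node l r)
    ≡⟨ planeForms-node-count l r ⟩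
  2 * ((length (planeForms l) * 2 ^ symNodes l) * (length (planeForms r) * 2 ^ symNodes r))
    ≡⟨ cong (2 *_) (cong₂ _*_ (planeForms-count l) (planeForms-count r)) ⟩
  2 * (2 ^ internal l * 2 ^ internal r)
    ≡⟨ cong (2 *_) (^-distribˡ-+-* 2 (internal l) (internal r)) ⟨
  2 ^ internal (node l r) ∎

planeForms-length : ∀ t → length (planeForms t) ≡ 2 ^ (internal t ∸ symNodes t)
planeForms-length t = *-cancelʳ-≡ _ _ (2 ^ symNodes t) {{m^n≢0 2 (symNodes t)}} (begin
  length (planeForms t) * 2 ^ symNodes t          ≡⟨ planeForms-count t ⟩
  2 ^ internal t                                   ≡⟨ cong (2 ^_) (m∸n+n≡m (symNodes≤internal t)) ⟨
  2 ^ (internal t ∸ symNodes t + symNodes t)       ≡⟨ ^-distribˡ-+-* 2 (internal t ∸ symNodes t) (symNodes t) ⟩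
  2 ^ (internal t ∸ symNodes t) * 2 ^ symNodes t   ∎)

-- Rankings of a plane tree

Increasing : List ℕ → Set
Increasing = AllPairs _<_

joinRanked : ℕ → (List ℕ → List RTree) → (List ℕ → List RTree) → List ℕ × List ℕ → List RTree
joinRanked x rankingsˡ rankingsʳ (l , r) = cartesianProductWith (node x) (rankingsˡ l) (rankingsʳ r)

rankings : Tree → List ℕ → List RTree
rankings leaf [] = [ leaf ]
rankings leaf (_ ∷ _) = []
rankings (node pl pr) [] = []
rankings (node pl pr) (x ∷ ys) =
  concatMap (joinRanked x (rankings pl) (rankings pr)) (splits ys (internal pl) (internal pr))

∈-rankings-node : ∀ pl pr x ys {T} → T ∈ rankings (node pl pr) (x ∷ ys) →
  ∃₂ λ l r → (l , r) ∈ splits ys (internal pl) (internal pr) ×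
    ∃₂ λ tl tr → tl ∈ rankings pl l × tr ∈ rankings pr r × T ≡ node x tl tr
∈-rankings-node pl pr x ys T∈ with ∈-concatMap-elim (joinRanked x (rankings pl) (rankings pr)) T∈
... | (l , r) , lr∈ , T∈′ = l , r , lr∈ , ∈-cartesianProductWith⁻ (node x) (rankings pl l) (rankings pr r) T∈′

ranks-length : ∀ T → length (ranks T) ≡ internal (shape T)
ranks-length leaf = refl
ranks-length (node _ l r) = cong suc (trans (length-++ (ranks l)) (cong₂ _+_ (ranks-length l) (ranks-length r)))

rankings-sound : ∀ p xs {T} → T ∈ rankings p xs → shape T ≡ p × ranks T ↭ xs
rankings-sound leaf [] (here refl) = refl , ↭-refl
rankings-sound (node pl pr) (x ∷ ys) T∈ with ∈-rankings-node pl pr x ys T∈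
... | l , r , lr∈ , tl , tr , tl∈ , tr∈ , refl =
  let (shape-l , ranks-l) = rankings-sound pl l tl∈
      (shape-r , ranks-r) = rankings-sound pr r tr∈
      (I , _ , _) = ∈-splits⁻ ys (internal pl) (internal pr) lr∈
  in cong₂ node shape-l shape-r , ↭-prep x (↭-trans (++⁺ ranks-l ranks-r) (↭-sym (toPermutation I)))

rankings-above : ∀ p xs {k T} → Increasing xs → All (k <_) xs → T ∈ rankings p xs → Above k T
rankings-above leaf [] _ _ (here refl) = tt
rankings-above (node pl pr) (x ∷ ys) (x<ys ∷ ys↑) (k<x ∷ _) T∈ with ∈-rankings-node pl pr x ys T∈
... | l , r , lr∈ , tl , tr , tl∈ , tr∈ , refl =
  let (I , _ , _) = ∈-splits⁻ ys (internal pl) (internal pr) lr∈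
      (l↑ , r↑) = interleaving-AllPairs I ys↑
  in k<x , rankings-above pl l l↑ (Allₚ.anti-mono (interleaving-⊆ˡ I) x<ys) tl∈
         , rankings-above pr r r↑ (Allₚ.anti-mono (interleaving-⊆ʳ I) x<ys) tr∈

above-ranks : ∀ {k} T → Above k T → All (k <_) (ranks T)
above-ranks leaf _ = []
above-ranks (node m l r) (k<m , l-above , r-above) =
  k<m ∷ Allₚ.++⁺ (All.map (<-trans k<m) (above-ranks l l-above)) (All.map (<-trans k<m) (above-ranks r r-above))

↭-minimum : ∀ {m x ms ys} → All (m <_) ms → All (x <_) ys → m ∷ ms ↭ x ∷ ys → m ≡ x
↭-minimum m<ms x<ys ρ with ∈-resp-↭ ρ (here refl)
... | here m≡x = m≡x
... | there m∈ys with ∈-resp-↭ (↭-sym ρ) (here refl)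
...   | here x≡m = sym x≡m
...   | there x∈ms = ⊥-elim (<-asym (All.lookup m<ms x∈ms) (All.lookup x<ys m∈ys))

rankings-complete : ∀ T {k xs} → Above k T → Increasing xs → ranks T ↭ xs → T ∈ rankings (shape T) xs
rankings-complete leaf _ _ ρ with refl ← ↭-empty-inv (↭-sym ρ) = here refl
rankings-complete (node m tl tr) {xs = []} _ _ ρ with () ← ↭-empty-inv ρ
rankings-complete (node m tl tr) {xs = x ∷ ys} (_ , tl-above , tr-above) (x<ys ∷ ys↑) ρ
  with refl ← ↭-minimum (Allₚ.++⁺ (above-ranks tl tl-above) (above-ranks tr tr-above)) x<ys ρ =
  let (l , r , I , ρl , ρr) = interleaving-of-↭ ys (drop-∷ ρ)
      (l↑ , r↑) = interleaving-AllPairs I ys↑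
      lr∈ = subst₂ (λ a b → (l , r) ∈ splits ys a b)
              (trans (sym (↭-length ρl)) (ranks-length tl)) (trans (sym (↭-length ρr)) (ranks-length tr))
              (∈-splits⁺ I)
  in ∈-concatMap-intro (joinRanked m (rankings (shape tl)) (rankings (shape tr))) lr∈
       (∈-cartesianProductWith⁺ (node m) (rankings-complete tl tl-above l↑ ρl) (rankings-complete tr tr-above r↑ ρr))

rnode-injective : ∀ {x a b c d} → RTree.node x a b ≡ node x c d → a ≡ c × b ≡ d
rnode-injective refl = refl , refl

-- With duplicate-free labels no ranked tree is listed twice: a tree determines
-- the labels of its left subtree, hence (by interleaving-determined) the split.
rankings-unique : ∀ p xs → Unique xs → Unique (rankings p xs)
rankings-unique leaf [] _ = [] ∷ []
rankings-unique leaf (_ ∷ _) _ = []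
rankings-unique (node pl pr) [] _ = []
rankings-unique (node pl pr) (x ∷ ys) (_ ∷ ys!) =
  concatMap-unique (joinRanked x (rankings pl) (rankings pr))
    (splits-unique ys (internal pl) (internal pr) ys!) joins-unique′ same-split
  where
  interleaving : ∀ {l r} → (l , r) ∈ splits ys (internal pl) (internal pr) → Interleaving l r ys
  interleaving lr∈ = proj₁ (∈-splits⁻ ys (internal pl) (internal pr) lr∈)
  joins-unique′ : ∀ {s} → s ∈ splits ys (internal pl) (internal pr) →
    Unique (joinRanked x (rankings pl) (rankings pr) s)
  joins-unique′ {l , r} lr∈ =
    let (l! , r!) = interleaving-AllPairs (interleaving lr∈) ys!
    in Unique.cartesianProductWith⁺ (node x) rnode-injective (rankings-unique pl l l!) (rankings-unique pr r r!)
  same-split : ∀ {s s′ T} → s ∈ splits ys (internal pl) (internal pr) → s′ ∈ splits ys (internal pl) (internal pr) →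
    T ∈ joinRanked x (rankings pl) (rankings pr) s → T ∈ joinRanked x (rankings pl) (rankings pr) s′ → s ≡ s′
  same-split {l , r} {l′ , r′} lr∈ lr∈′ T∈ T∈′
    with ∈-cartesianProductWith⁻ (node x) (rankings pl l) (rankings pr r) T∈
       | ∈-cartesianProductWith⁻ (node x) (rankings pl l′) (rankings pr r′) T∈′
  ... | tl , _ , tl∈ , _ , refl | _ , _ , tl∈′ , _ , refl =
    interleaving-determined ys! (interleaving lr∈) (interleaving lr∈′)
      (↭-trans (↭-sym (proj₂ (rankings-sound pl l tl∈))) (proj₂ (rankings-sound pl l′ tl∈′)))

rankings-count : ∀ p xs → length xs ≡ internal p → length (rankings p xs) * prodSub p ≡ internal p !
rankings-count leaf [] _ = refl
rankings-count (node pl pr) (x ∷ ys) |xs| = begin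
  length (concatMap J S) * (suc (a + b) * (prodSub pl * prodSub pr))
    ≡⟨ x∙yz≈y∙xz (length (concatMap J S)) (suc (a + b)) _ ⟩
  suc (a + b) * (length (concatMap J S) * (prodSub pl * prodSub pr))
    ≡⟨ cong (suc (a + b) *_) (length-concatMap J S per-split) ⟩
  suc (a + b) * (length S * (a ! * b !))
    ≡⟨ cong (suc (a + b) *_) (splits-count ys a b (suc-injective |xs|)) ⟩
  suc (a + b) * (a + b) ! ∎
  where
  a = internal pl
  b = internal pr
  J = joinRanked x (rankings pl) (rankings pr)
  S = splits ys a b
  per-split : ∀ {s} → s ∈ S → length (J s) * (prodSub pl * prodSub pr) ≡ a ! * b !
  per-split {l , r} lr∈ = let (_ , |l| , |r|) = ∈-splits⁻ ys a b lr∈ in begin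
    length (cartesianProductWith (node x) (rankings pl l) (rankings pr r)) * (prodSub pl * prodSub pr)
      ≡⟨ cong (_* (prodSub pl * prodSub pr)) (length-cartesianProductWith (node x) (rankings pl l) (rankings pr r)) ⟩
    (length (rankings pl l) * length (rankings pr r)) * (prodSub pl * prodSub pr)
      ≡⟨ interchange (length (rankings pl l)) _ _ _ ⟩
    (length (rankings pl l) * prodSub pl) * (length (rankings pr r) * prodSub pr)
      ≡⟨ cong₂ _*_ (rankings-count pl l |l|) (rankings-count pr r |r|) ⟩
    a ! * b ! ∎

-- Ranked plane trees over a rooted tree

rankedForms : Tree → List ℕ → List RTree
rankedForms t xs = concatMap (λ p → rankings p xs) (planeForms t)

rankedForms-unique : ∀ t {xs} → Unique xs → Unique (rankedForms t xs)
rankedForms-unique t {xs} xs! =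
  concatMap-unique (λ p → rankings p xs) (planeForms-unique t) (λ {p} _ → rankings-unique p xs xs!)
    (λ {p} {p′} _ _ T∈ T∈′ → trans (sym (proj₁ (rankings-sound p xs T∈))) (proj₁ (rankings-sound p′ xs T∈′)))

rankedForms-sound : ∀ t {k xs T} → Increasing xs → All (k <_) xs → T ∈ rankedForms t xs →
  shape T ≅ t × ranks T ↭ xs × Above k T
rankedForms-sound t {xs = xs} xs↑ k<xs T∈ with ∈-concatMap-elim (λ p → rankings p xs) T∈
... | p , p∈ , T∈′ with refl , ρ ← rankings-sound p xs T∈′ =
  planeForms-sound t p∈ , ρ , rankings-above p xs xs↑ k<xs T∈′

rankedForms-complete : ∀ t {k xs T} → Increasing xs → shape T ≅ t → ranks T ↭ xs → Above k T →
  T ∈ rankedForms t xs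
rankedForms-complete t {xs = xs} {T} xs↑ iso ρ above =
  ∈-concatMap-intro (λ p → rankings p xs) (planeForms-complete t iso) (rankings-complete T above xs↑ ρ)

-- Plane forms of t are isomorphic to t, so all have the same hook product;
-- multiplying by their number gives the formula.
rankedForms-count : ∀ t xs → length xs ≡ internal t →
  length (rankedForms t xs) * prodSub t ≡ internal t ! * 2 ^ (internal t ∸ symNodes t)
rankedForms-count t xs |xs| = begin
  length (rankedForms t xs) * prodSub t                ≡⟨ length-concatMap (λ p → rankings p xs) (planeForms t) per-form ⟩
  length (planeForms t) * internal t !                  ≡⟨ cong (_* internal t !) (planeForms-length t) ⟩
  2 ^ (internal t ∸ symNodes t) * internal t !          ≡⟨ *-comm (2 ^ (internal t ∸ symNodes t)) (internal t !) ⟩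
  internal t ! * 2 ^ (internal t ∸ symNodes t)          ∎
  where
  per-form : ∀ {p} → p ∈ planeForms t → length (rankings p xs) * prodSub t ≡ internal t !
  per-form {p} p∈ = let iso = planeForms-sound t p∈ in begin
    length (rankings p xs) * prodSub t  ≡⟨ cong (length (rankings p xs) *_) (≅-prodSub iso) ⟨
    length (rankings p xs) * prodSub p  ≡⟨ rankings-count p xs (trans |xs| (sym (≅-internal iso))) ⟩
    internal p !                        ≡⟨ cong _! (≅-internal iso) ⟩
    internal t !                        ∎

labels : ℕ → List ℕ
labels k = map suc (upTo k)

labels-increasing : ∀ k → Increasing (labels k)
labels-increasing k = AllPairsₚ.map⁺ (AllPairs.map s≤s (AllPairsₚ.applyUpTo⁺₁ id k (λ i<j _ → i<j)))

labels-positive : ∀ k → All (0 <_) (labels k)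
labels-positive k = Allₚ.map⁺ (All.universal (λ _ → s≤s z≤n) (upTo k))

labels-length : ∀ k → length (labels k) ≡ k
labels-length k = trans (length-map suc (upTo k)) (length-upTo k)

root-rank-one : ∀ k T → Above 0 T → ranks T ↭ labels k → RootRankOne T
root-rank-one k leaf _ _ = tt
root-rank-one zero (node m l r) _ ρ with () ← ↭-empty-inv ρ
root-rank-one (suc k) (node m l r) (_ , l-above , r-above) ρ =
  ↭-minimum (Allₚ.++⁺ (above-ranks l l-above) (above-ranks r r-above)) (AllPairs.head (labels-increasing (suc k))) ρ

-- The theorem.  The list is rankedForms t (labels (n ∸ 1)).

mainTheorem3 : (n : ℕ) → 2 ≤ n → (t : Tree) → leaves (t) ≡ n →
    Σ (List RTree) (λ L →
      Unique L ×
      ((T : RTree) → (T ∈ L) ⇔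
         (((leaves (shape T) ≡ n) × (ranks T ↭ map suc (upTo (n ∸ 1))) ×
           RootRankOne T × Above 0 T) × (shape T ≅ t))) ×
      (length L * prodSub t ≡ ((n ∸ 1) !) * 2 ^ (n ∸ 1 ∸ symNodes t)))
mainTheorem3 n _ t |t|≡n =
  rankedForms t (labels k) ,
  rankedForms-unique t (AllPairs.map <⇒≢ (labels-increasing k)) ,
  (λ T → mk⇔
    (λ T∈ → let (iso , ρ , above) = rankedForms-sound t (labels-increasing k) (labels-positive k) T∈
            in (trans (≅-leaves iso) |t|≡n , ρ , root-rank-one k T above ρ , above) , iso)
    (λ ((_ , ρ , _ , above) , iso) → rankedForms-complete t (labels-increasing k) iso ρ above)) ,
  subst (λ i → length (rankedForms t (labels k)) * prodSub t ≡ i ! * 2 ^ (i ∸ symNodes t)) internal≡k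
    (rankedForms-count t (labels k) (trans (labels-length k) (sym internal≡k)))
  where
  k = n ∸ 1
  internal≡k : internal t ≡ k
  internal≡k = cong (_∸ 1) (trans (sym (leaves≡suc-internal t)) |t|≡n)
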